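{- Let $n\ge2$, $\lambda$ a partition with at most $n-1$ non-zero parts, $w\in S_n$ and $J=\{j_1<\dots<j_s\}\subseteq[m]$ arbitrary, with $T$ the corresponding subsequence of $\Gamma$ and $\sigma=f(w,T)$. Fix $k\in[m]$, let $i=i(k)$ be the largest index with $j_i<k$ ($i=0$ if none), let $\beta_k=(a,b)$ lie in the segment $\Gamma_q$, let $w_i=wr_{j_1}\cdots r_{j_i}$, $c=w_i(a)$, $d=w_i(b)$ and $\gamma=\varepsilon_c-\varepsilon_d$ (possibly $c>d$). Then the affine hyperplane $w\hat r_{j_1}\cdots\hat r_{j_i}(H_{\beta_k,l_k})$ equals $H_{\gamma,m_k}$ with $$m_k=\langle\mathrm{ct}(\sigma[q]),\gamma^\vee\rangle=N_c(\sigma[q])-N_d(\sigma[q]).$$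
   Context: Permutations in one-line notation; $(a,b)$, $a<b$, denotes the transposition and also the root $\varepsilon_a-\varepsilon_b$ of type $A_{n-1}$, where $\varepsilon_1,\dots,\varepsilon_n$ are the standard basis vectors of $\mathbb{R}^n$; $\langle\cdot,\cdot\rangle$ is the standard scalar product and $\alpha^\vee=\alpha$ for roots. $S_n$ acts linearly on $\mathbb{R}^n$ by $w(\varepsilon_i)=\varepsilon_{w(i)}$. $H_{\alpha,k}=\{\mu:\langle\mu,\alpha\rangle=k\}$. $\lambda'_j=\#\{i:\lambda_i\ge j\}$. For $1\le k\le n-1$, $\Gamma(k)=((1,n),(1,n-1),\dots,(1,k+1),(2,n),\dots,(2,k+1),\dots,(k,n),\dots,(k,k+1))$; $\Gamma=\Gamma_{\lambda_1}\cdots\Gamma_1$ with $\Gamma_j=\Gamma(\lambda'_j)$, written $\Gamma=(\beta_1,\dots,\beta_m)$; $r_p$ is the transposition $\beta_p$; $l_p=\#\{i\le p:\beta_i=\beta_p\}$ and $\hat r_p$ is the affine reflection in $H_{\beta_p,l_p}$, i.e. for $\beta_p=(a,b)$ it replaces $\mu_a$ by $\mu_b+l_p$ and $\mu_b$ by $\mu_a-l_p$. The subsequence $T$ indexed by $J$ splits as $T=T_{\lambda_1}\cdots T_1$, $T_j$ the entries in $\Gamma_j$. Filling map: $\pi_j=wT_{\lambda_1}\cdots T_{j+1}$ (products of transpositions, right multiplication swapping positions), and $f(w,T)(i,j)=\pi_j(i)$ on cells $(i,j)$, $1\le j\le\lambda_i$; columns are numbered $\lambda_1,\dots,1$ from left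 to right. $\sigma[q]$ denotes the part of $\sigma$ consisting of the columns $\lambda_1,\lambda_1-1,\dots,q$; $\mathrm{ct}(\phi)\in\mathbb{Z}^n$ has $e$-th coordinate $N_e(\phi)$, the number of entries of $\phi$ equal to $e$.
   Formalization: The hyperplanes $H_{\beta_k,l_k}$ and $H_{\gamma,m_k}$, and the affine map $w\hat r_{j_1}\cdots\hat r_{j_i}$ acting on them, are taken in ℚ^n instead of ℝ^n. -}

module Defs where

open import Data.Bool.Base using (Bool; true; false; if_then_else_; _∧_; not)
open import Data.Nat.Base using (ℕ; zero; suc; _≤_; _<_; _∸_; _⊔_; _≤ᵇ_; _<ᵇ_)
open import Data.Fin.Base using (Fin; toℕ)
open import Data.Fin.Properties using (_≟_)
open import Data.Fin.Subset using (Subset)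
open import Data.Fin.Permutation using (Permutation′; _⟨$⟩ʳ_; _⟨$⟩ˡ_)
import Data.Fin.Permutation.Components as PC
open import Data.List.Base using (List; []; _∷_; length; filterᵇ; map; concatMap;
  downFrom; lookup; foldr; reverse; allFin)
open import Data.Nat.ListAction using (sum)
open import Data.Vec.Base as Vec using ()
open import Data.Product.Base using (_×_; _,_; proj₁; proj₂; Σ; ∃)
open import Data.Integer.Base as ℤ using (ℤ)
open import Data.Rational.Base using (ℚ; _+_; _-_; _/_)
open import Relation.Nullary.Decidable.Core using (does)
open import Relation.Binary.PropositionalEquality using (_≡_)

-- Conventions: [n] = Fin n (0-based: the element i of Fin n stands for i+1).
-- Vectors of ℝ^n are modelled by Fin n → ℚ.

_==_ : ∀ {n} → Fin n → Fin n → Bool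
x == y = does (x ≟ y)

countᵇ : ∀ {A : Set} → (A → Bool) → List A → ℕ
countᵇ p xs = length (filterᵇ p xs)

record Partition (n : ℕ) : Set where
  field
    parts    : Fin n → ℕ
    antitone : ∀ (i j : Fin n) → toℕ i ≤ toℕ j → parts j ≤ parts i

open Partition public

nonzeroParts : ∀ {n} → Partition n → ℕ
nonzeroParts {n} la = countᵇ (λ i → not (parts la i ≤ᵇ 0)) (allFin n)

λ₁ : ∀ {n} → Partition n → ℕ
λ₁ {n} la = foldr _⊔_ 0 (map (parts la) (allFin n))

conj : ∀ {n} → Partition n → ℕ → ℕ
conj {n} la j = countᵇ (λ i → j ≤ᵇ parts la i) (allFin n)

-- The λ-chain Γ.
-- Γ(k) = ((1,n),(1,n-1),…,(1,k+1),(2,n),…,(2,k+1),…,(k,n),…,(k,k+1))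
-- (here with 0-based letters: a < k ≤ b).

Γk : (n k : ℕ) → List (Fin n × Fin n)
Γk n k = concatMap (λ a → map (λ b → (a , b)) Bs) As
  where
  As : List (Fin n)
  As = filterᵇ (λ a → toℕ a <ᵇ k) (allFin n)
  Bs : List (Fin n)
  Bs = reverse (filterᵇ (λ b → k ≤ᵇ toℕ b) (allFin n))

-- Γ = Γ_{λ_1} ⋯ Γ_1 with Γ_j = Γ(λ'_j).  Each entry is tagged with the
-- index j of the segment Γ_j containing it.
Γtagged : ∀ {n} → Partition n → List (ℕ × (Fin n × Fin n))
Γtagged {n} la =
  concatMap (λ j → map (λ ab → (j , ab)) (Γk n (conj la j)))
            (map suc (downFrom (λ₁ la)))

-- m = length of Γ ; positions of Γ are Fin m (position p stands for p+1)
len : ∀ {n} → Partition n → ℕ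
len la = length (Γtagged la)

module _ {n : ℕ} (la : Partition n) where

  β : Fin (len la) → Fin n × Fin n
  β p = proj₂ (lookup (Γtagged la) p)

  seg : Fin (len la) → ℕ
  seg p = proj₁ (lookup (Γtagged la) p)

  lev : Fin (len la) → ℕ
  lev p = countᵇ (λ i → (toℕ i ≤ᵇ toℕ p) ∧
                         ((proj₁ (β i) == proj₁ (β p)) ∧ (proj₂ (β i) == proj₂ (β p))))
                 (allFin (len la))

  inJ : Subset (len la) → Fin (len la) → Bool
  inJ J p = Vec.lookup J p

  Jbelow : Subset (len la) → Fin (len la) → List (Fin (len la))
  Jbelow J k = filterᵇ (λ p → inJ J p ∧ (toℕ p <ᵇ toℕ k)) (allFin (len la))

  -- elements of J lying in the segments Γ_{λ_1}, …, Γ_{j+1} (increasing),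
  -- i.e. the entries of T_{λ_1} ⋯ T_{j+1}
  Jabove : Subset (len la) → ℕ → List (Fin (len la))
  Jabove J j = filterᵇ (λ p → inJ J p ∧ (j <ᵇ seg p)) (allFin (len la))

  permProd : Permutation′ n → List (Fin (len la)) → Fin n → Fin n
  permProd w ps x =
    w ⟨$⟩ʳ foldr (λ p y → PC.transpose (proj₁ (β p)) (proj₂ (β p)) y) x ps

  π : Permutation′ n → Subset (len la) → ℕ → Fin n → Fin n
  π w J j = permProd w (Jabove J j)

  filling : Permutation′ n → Subset (len la) → Fin n → ℕ → Fin n
  filling w J i j = π w J j i

  Ncount : Permutation′ n → Subset (len la) → ℕ → Fin n → ℕ
  Ncount w J q e =
    sum (map (λ i → countᵇ (λ j → (q ≤ᵇ j) ∧ (filling w J i j == e))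
                            (map suc (downFrom (parts la i))))
             (allFin n))

  affRefl : Fin (len la) → (Fin n → ℚ) → (Fin n → ℚ)
  affRefl p μ x =
    if x == a then μ b + l else if x == b then μ a - l else μ x
    where
    a = proj₁ (β p)
    b = proj₂ (β p)
    l = ℤ.+ (lev p) / 1

  affProd : Permutation′ n → List (Fin (len la)) → (Fin n → ℚ) → (Fin n → ℚ)
  affProd w ps μ = permAct w (foldr affRefl μ ps)
    where
    -- S_n action: w(ε_i) = ε_{w(i)}, so (wμ)_y = μ_{w⁻¹(y)}
    permAct : Permutation′ n → (Fin n → ℚ) → (Fin n → ℚ)
    permAct w μ y = μ (w ⟨$⟩ˡ y)

Hyp : ∀ {n} → Fin n → Fin n → ℚ → (Fin n → ℚ) → Set
Hyp c d k μ = μ c - μ d ≡ k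

Image : ∀ {n} → ((Fin n → ℚ) → (Fin n → ℚ)) → ((Fin n → ℚ) → Set) → (Fin n → ℚ) → Set
Image {n} F H μ = Σ (Fin n → ℚ) (λ ν → H ν × (∀ x → F ν x ≡ μ x))

SameSet : ∀ {n} → ((Fin n → ℚ) → Set) → ((Fin n → ℚ) → Set) → Set
SameSet {n} H H' = ∀ (μ : Fin n → ℚ) → (H μ → H' μ) × (H' μ → H μ)

module Submission where

-- Let ρ_q ∈ ℚⁿ count, for each row z of λ, the cells of row z in the columns ≥ q, and let
-- θ_q = ct(σ[q]).  A product of affine reflections r̂_{p₁} ⋯ r̂_{pₜ} is an affine map whose
-- linear part is the permutation r_{p₁} ⋯ r_{pₜ} (module Affine), so w r̂_{j₁} ⋯ r̂_{jᵢ} maps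
-- H_{β_k, l_k} onto H_{γ, l_k + C a - C b}, C its translation part (hyperplane-image).  The
-- heart of the proof is the identity w r̂_{j₁} ⋯ r̂_{jᵢ} (ρ_q) = θ_q (sends-below): since ρ_q lies
-- on H_{β_k, l_k} (lev-shape), it turns the constant into θ_q(c) - θ_q(d).  The identity is proved
-- by descending induction on q (module Filling): beyond λ₁ both sides vanish; the reflections of
-- the segment Γ_q fix ρ_q, again by lev-shape; and passing from q + 1 to q adds to both sides the
-- cells of column q, which σ fills through π_q.  The combinatorics of the chain (module Chain)
-- gives lev-shape: l_p counts the segments Γ_{λ₁}, …, Γ_q containing β_p = (a, b), and these are
-- the Γ_j with q ≤ j ≤ λ_a, as many as row a has cells in the columns ≥ q.

open import Defs
open import Data.Bool.Base using (Bool; true; false; if_then_else_; _∧_; _∨_; T)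
open import Data.Nat.Base using (ℕ; zero; suc)
open import Data.Fin.Base using (Fin; toℕ)
open import Data.Fin.Properties using (_≟_)
open import Data.Fin.Subset using (Subset)
open import Data.Fin.Permutation using (Permutation′; _⟨$⟩ʳ_; _⟨$⟩ˡ_; inverseˡ; inverseʳ; _∘ₚ_; transpose; id)
import Data.Fin.Permutation.Components as PC
open import Data.List.Base using (List; []; _∷_; _++_; foldr)
open import Data.List.Properties using (foldr-++)
open import Data.List.Relation.Unary.All using (All; []; _∷_)
open import Data.Product.Base using (Σ; _×_; _,_; proj₁; proj₂)
open import Function.Base using (_∘_; _$_)
open import Data.Integer.Base as ℤ using (ℤ)
import Data.Integer.Properties as ℤP
open import Data.Rational.Base using (ℚ; mkℚ; _/_; 0ℚ)
import Data.Nat.Coprimality as Coprime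
open import Relation.Binary.PropositionalEquality hiding ([_])
open import Relation.Nullary using (¬_; Dec; yes; no; contradiction; T?)
open import Relation.Nullary.Decidable using (dec-true; dec-false)

==-refl : ∀ {n} (x : Fin n) → (x == x) ≡ true
==-refl x = dec-true (x ≟ x) refl

==-≢ : ∀ {n} {x y : Fin n} → x ≢ y → (x == y) ≡ false
==-≢ {x = x} {y} x≢y = dec-false (x ≟ y) x≢y

transpose-left : ∀ {n} (i j : Fin n) → PC.transpose i j i ≡ j
transpose-left i j rewrite dec-true (i ≟ i) refl = refl

transpose-right : ∀ {n} {i j : Fin n} → j ≢ i → PC.transpose i j j ≡ i
transpose-right {i = i} {j} j≢i rewrite dec-false (j ≟ i) j≢i | dec-true (j ≟ j) refl = refl

transpose-other : ∀ {n} {i j k : Fin n} → k ≢ i → k ≢ j → PC.transpose i j k ≡ k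
transpose-other {i = i} {j} {k} k≢i k≢j rewrite dec-false (k ≟ i) k≢i | dec-false (k ≟ j) k≢j = refl

module _ where
  open import Data.Nat.Base using (_≤_; _<_; _≤ᵇ_; _<ᵇ_; _≡ᵇ_)
  open import Data.Nat.Properties using (≤ᵇ⇒≤; ≤⇒≤ᵇ; <ᵇ⇒<; <⇒<ᵇ)

  T-true : ∀ {b} → T b → b ≡ true
  T-true {true} _ = refl

  T-false : ∀ {b} → ¬ T b → b ≡ false
  T-false {true}  ¬t = contradiction _ ¬t
  T-false {false} _  = refl

  true-T : ∀ {b} → b ≡ true → T b
  true-T refl = _

  T-∧⁻ : ∀ {x y} → T (x ∧ y) → T x × T y
  T-∧⁻ {true} t = _ , t

  ≤ᵇ-true : ∀ {m n} → m ≤ n → (m ≤ᵇ n) ≡ true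
  ≤ᵇ-true m≤n = T-true (≤⇒≤ᵇ m≤n)

  ≤ᵇ-false : ∀ {m n} → ¬ m ≤ n → (m ≤ᵇ n) ≡ false
  ≤ᵇ-false {m} {n} m≰n = T-false (λ t → m≰n (≤ᵇ⇒≤ m n t))

  ≤ᵇ-sound : ∀ {m n} → (m ≤ᵇ n) ≡ true → m ≤ n
  ≤ᵇ-sound {m} {n} e = ≤ᵇ⇒≤ m n (true-T e)

  <ᵇ-true : ∀ {m n} → m < n → (m <ᵇ n) ≡ true
  <ᵇ-true m<n = T-true (<⇒<ᵇ m<n)

  <ᵇ-false : ∀ {m n} → ¬ m < n → (m <ᵇ n) ≡ false
  <ᵇ-false {m} {n} m≮n = T-false (λ t → m≮n (<ᵇ⇒< m n t))

  <ᵇ-sound : ∀ {m n} → (m <ᵇ n) ≡ true → m < n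
  <ᵇ-sound {m} {n} e = <ᵇ⇒< m n (true-T e)

  <ᵇ-split : ∀ q s → (q <ᵇ s) ≡ ((suc q <ᵇ s) ∨ (s ≡ᵇ suc q))
  <ᵇ-split zero    zero          = refl
  <ᵇ-split zero    (suc zero)    = refl
  <ᵇ-split zero    (suc (suc s)) = refl
  <ᵇ-split (suc q) zero          = refl
  <ᵇ-split (suc q) (suc s)       = <ᵇ-split q s

  ≤ᵇ-as-<ᵇ : ∀ m n → (m ≤ᵇ n) ≡ (m <ᵇ suc n)
  ≤ᵇ-as-<ᵇ zero    n = refl
  ≤ᵇ-as-<ᵇ (suc m) n = refl

module Affine where

  open import Data.Rational.Base using (_+_; _-_; -_)
  open import Data.Rational.Properties using (↥p/↧p≡p; /-cong; +-assoc; +-identityʳ)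
  open import Data.Rational.Solver using (module +-*-Solver)
  open +-*-Solver using (solve; _:+_; _:-_; _:=_)

  ι : ℤ → ℚ
  ι i = i / 1

  ι-mkℚ : ∀ i → ι i ≡ mkℚ i 0 (Coprime.sym (Coprime.1-coprimeTo _))
  ι-mkℚ i = ↥p/↧p≡p (mkℚ i 0 (Coprime.sym (Coprime.1-coprimeTo _)))

  ι-+ : ∀ i j → ι (i ℤ.+ j) ≡ ι i + ι j
  ι-+ i j rewrite ι-mkℚ i | ι-mkℚ j =
    /-cong {i ℤ.+ j} (sym (cong₂ ℤ._+_ (ℤP.*-identityʳ i) (ℤP.*-identityʳ j))) refl

  ι-neg : ∀ i → ι (ℤ.- i) ≡ - ι i
  ι-neg i rewrite ι-mkℚ i | ι-mkℚ (ℤ.- i) = on-normal-forms i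
    where
    on-normal-forms : ∀ i → mkℚ (ℤ.- i) 0 (Coprime.sym (Coprime.1-coprimeTo _))
                            ≡ - mkℚ i 0 (Coprime.sym (Coprime.1-coprimeTo _))
    on-normal-forms ℤ.-[1+ n ]     = refl
    on-normal-forms (ℤ.+ zero)    = refl
    on-normal-forms (ℤ.+ (suc n)) = refl

  ι-- : ∀ i j → ι (i ℤ.- j) ≡ ι i - ι j
  ι-- i j = trans (ι-+ i (ℤ.- j)) (cong (ι i +_) (ι-neg j))

  -- A family of affine reflections of type A indexed by I: p reflects ℚⁿ in the hyperplane
  -- μ_{a p} - μ_{b p} = l p.  A product r̂_{p₁} ⋯ r̂_{pₜ} is an affine map whose linear part is
  -- the permutation r_{p₁} ⋯ r_{pₜ}; its translation part is computed explicitly.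
  module Reflections {n : ℕ} {I : Set} (a b : I → Fin n) (l : I → ℚ)
                     (a≢b : ∀ p → a p ≢ b p) where

    reflect : I → (Fin n → ℚ) → Fin n → ℚ
    reflect p μ x = if x == a p then μ (b p) + l p else if x == b p then μ (a p) - l p else μ x

    reflectAll : List I → (Fin n → ℚ) → Fin n → ℚ
    reflectAll ps ν = foldr reflect ν ps

    swapAll : List I → Fin n → Fin n
    swapAll ps x = foldr (λ p y → PC.transpose (a p) (b p) y) x ps

    -- r_{ps} as a permutation, giving its inverse and injectivity
    swapPerm : List I → Permutation′ n
    swapPerm []       = id
    swapPerm (p ∷ ps) = swapPerm ps ∘ₚ transpose (a p) (b p)

    swapPerm-apply : ∀ ps x → swapPerm ps ⟨$⟩ʳ x ≡ swapAll ps x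
    swapPerm-apply []       x = refl
    swapPerm-apply (p ∷ ps) x = cong (PC.transpose (a p) (b p)) (swapPerm-apply ps x)

    unswap : List I → Fin n → Fin n
    unswap ps y = swapPerm ps ⟨$⟩ˡ y

    swapAll-unswap : ∀ ps y → swapAll ps (unswap ps y) ≡ y
    swapAll-unswap ps y = trans (sym (swapPerm-apply ps (unswap ps y))) (inverseʳ (swapPerm ps))

    swapAll-injective : ∀ ps {x y} → swapAll ps x ≡ swapAll ps y → x ≡ y
    swapAll-injective ps {x} {y} e = begin
      x                                            ≡⟨ inverseˡ (swapPerm ps) ⟨
      swapPerm ps ⟨$⟩ˡ (swapPerm ps ⟨$⟩ʳ x)         ≡⟨ cong (swapPerm ps ⟨$⟩ˡ_) (trans (swapPerm-apply ps x) e) ⟩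
      swapPerm ps ⟨$⟩ˡ swapAll ps y                 ≡⟨ cong (swapPerm ps ⟨$⟩ˡ_) (swapPerm-apply ps y) ⟨
      swapPerm ps ⟨$⟩ˡ (swapPerm ps ⟨$⟩ʳ y)         ≡⟨ inverseˡ (swapPerm ps) ⟩
      y                                            ∎
      where open ≡-Reasoning

    -- the translation of one reflection, read off at the preimage y of the moved point,
    -- and of a product
    shift : I → Fin n → ℚ
    shift p y = if y == a p then - l p else if y == b p then l p else 0ℚ

    translation : List I → Fin n → ℚ
    translation []       x = 0ℚ
    translation (p ∷ ps) x = translation ps x + shift p (swapAll ps x)

    reflect-transpose : ∀ p f y → reflect p f (PC.transpose (a p) (b p) y) ≡ f y + shift p y
    reflect-transpose p f y = by-cases y (y ≟ a p) (y ≟ b p)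
      where
      by-cases : ∀ y → Dec (y ≡ a p) → Dec (y ≡ b p) →
                 reflect p f (PC.transpose (a p) (b p) y) ≡ f y + shift p y
      by-cases _ (yes refl) _
        rewrite transpose-left (a p) (b p) | ==-≢ (≢-sym (a≢b p)) | ==-refl (b p) | ==-refl (a p) = refl
      by-cases _ (no y≢a) (yes refl)
        rewrite transpose-right (≢-sym (a≢b p)) | ==-refl (a p) | ==-≢ y≢a | ==-refl (b p) = refl
      by-cases y (no y≢a) (no y≢b)
        rewrite transpose-other y≢a y≢b | ==-≢ y≢a | ==-≢ y≢b = sym (+-identityʳ (f y))

    reflectAll-affine : ∀ ps ν x → reflectAll ps ν (swapAll ps x) ≡ ν x + translation ps x
    reflectAll-affine []       ν x = sym (+-identityʳ (ν x))
    reflectAll-affine (p ∷ ps) ν x = begin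
      reflect p (reflectAll ps ν) (PC.transpose (a p) (b p) (swapAll ps x))
        ≡⟨ reflect-transpose p (reflectAll ps ν) (swapAll ps x) ⟩
      reflectAll ps ν (swapAll ps x) + shift p (swapAll ps x)
        ≡⟨ cong (_+ shift p (swapAll ps x)) (reflectAll-affine ps ν x) ⟩
      (ν x + translation ps x) + shift p (swapAll ps x)
        ≡⟨ +-assoc (ν x) (translation ps x) (shift p (swapAll ps x)) ⟩
      ν x + translation (p ∷ ps) x ∎
      where open ≡-Reasoning

    swapAll-++ : ∀ xs ys x → swapAll (xs ++ ys) x ≡ swapAll xs (swapAll ys x)
    swapAll-++ xs ys x = foldr-++ (λ p y → PC.transpose (a p) (b p) y) x xs ys

    translation-++ : ∀ xs ys x →
      translation (xs ++ ys) x ≡ translation ys x + translation xs (swapAll ys x)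
    translation-++ []       ys x = sym (+-identityʳ (translation ys x))
    translation-++ (p ∷ xs) ys x = begin
      translation (xs ++ ys) x + shift p (swapAll (xs ++ ys) x)
        ≡⟨ cong₂ _+_ (translation-++ xs ys x) (cong (shift p) (swapAll-++ xs ys x)) ⟩
      (translation ys x + translation xs (swapAll ys x)) + shift p (swapAll xs (swapAll ys x))
        ≡⟨ +-assoc (translation ys x) _ _ ⟩
      translation ys x + translation (p ∷ xs) (swapAll ys x) ∎
      where open ≡-Reasoning

    reflect-cong : ∀ p {f g : Fin n → ℚ} → (∀ x → f x ≡ g x) → ∀ x → reflect p f x ≡ reflect p g x
    reflect-cong p f≗g x rewrite f≗g (a p) | f≗g (b p) | f≗g x = refl

    reflect-fixes : ∀ p {ν : Fin n → ℚ} → ν (a p) ≡ ν (b p) + l p → ∀ x → reflect p ν x ≡ ν x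
    reflect-fixes p {ν} on-H x = by-cases x (x ≟ a p) (x ≟ b p)
      where
      by-cases : ∀ x → Dec (x ≡ a p) → Dec (x ≡ b p) → reflect p ν x ≡ ν x
      by-cases _ (yes refl) _ rewrite ==-refl (a p) = sym on-H
      by-cases _ (no x≢a) (yes refl) rewrite ==-≢ x≢a | ==-refl (b p) =
        trans (cong (_- l p) on-H) (solve 2 (λ u v → (u :+ v) :- v := u) refl (ν (b p)) (l p))
      by-cases x (no x≢a) (no x≢b) rewrite ==-≢ x≢a | ==-≢ x≢b = refl

    invariant-shift : ∀ ps {ν : Fin n → ℚ} → All (λ p → ν (a p) ≡ ν (b p) + l p) ps →
      ∀ x → ν (swapAll ps x) ≡ ν x + translation ps x
    invariant-shift ps {ν} on-Hs x = trans (sym (fixed ps on-Hs (swapAll ps x))) (reflectAll-affine ps ν x)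
      where
      fixed : ∀ ps → All (λ p → ν (a p) ≡ ν (b p) + l p) ps → ∀ x → reflectAll ps ν x ≡ ν x
      fixed []       []             x = refl
      fixed (p ∷ ps) (on-H ∷ on-Hs) x = trans (reflect-cong p (fixed ps on-Hs) x) (reflect-fixes p on-H x)

  hyperplane-image : ∀ {n} (G : (Fin n → ℚ) → Fin n → ℚ) (g g⁻¹ : Fin n → Fin n) (C : Fin n → ℚ) →
    (∀ y → g (g⁻¹ y) ≡ y) → (∀ ν x → G ν (g x) ≡ ν x + C x) →
    ∀ a b l → SameSet (Image G (Hyp a b l)) (Hyp (g a) (g b) ((l + C a) - C b))
  hyperplane-image {n} G g g⁻¹ C g∘g⁻¹ affine a b l μ = into , onto
    where
    open ≡-Reasoning

    into : Image G (Hyp a b l) μ → Hyp (g a) (g b) ((l + C a) - C b) μ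
    into (ν , ν∈H , Gν≗μ) = begin
      μ (g a) - μ (g b)
        ≡⟨ cong₂ _-_ (sym (Gν≗μ (g a))) (sym (Gν≗μ (g b))) ⟩
      G ν (g a) - G ν (g b)
        ≡⟨ cong₂ _-_ (affine ν a) (affine ν b) ⟩
      (ν a + C a) - (ν b + C b)
        ≡⟨ solve 4 (λ νa νb Ca Cb → (νa :+ Ca) :- (νb :+ Cb) := ((νa :- νb) :+ Ca) :- Cb)
                   refl (ν a) (ν b) (C a) (C b) ⟩
      ((ν a - ν b) + C a) - C b
        ≡⟨ cong (λ t → (t + C a) - C b) ν∈H ⟩
      (l + C a) - C b ∎

    onto : Hyp (g a) (g b) ((l + C a) - C b) μ → Image G (Hyp a b l) μ
    onto μ∈H = ν , ν∈H , Gν≗μ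
      where
      ν : Fin n → ℚ
      ν x = μ (g x) - C x

      Gν≗μ : ∀ y → G ν y ≡ μ y
      Gν≗μ y = begin
        G ν y                  ≡⟨ cong (G ν) (sym (g∘g⁻¹ y)) ⟩
        G ν (g x)              ≡⟨ affine ν x ⟩
        (μ (g x) - C x) + C x  ≡⟨ solve 2 (λ u c → (u :- c) :+ c := u) refl (μ (g x)) (C x) ⟩
        μ (g x)                ≡⟨ cong μ (g∘g⁻¹ y) ⟩
        μ y                    ∎
        where x = g⁻¹ y

      ν∈H : ν a - ν b ≡ l
      ν∈H = begin
        (μ (g a) - C a) - (μ (g b) - C b)
          ≡⟨ solve 4 (λ u v Ca Cb → (u :- Ca) :- (v :- Cb) := ((u :- v) :- Ca) :+ Cb)
                     refl (μ (g a)) (μ (g b)) (C a) (C b) ⟩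
        ((μ (g a) - μ (g b)) - C a) + C b
          ≡⟨ cong (λ t → (t - C a) + C b) μ∈H ⟩
        (((l + C a) - C b) - C a) + C b
          ≡⟨ solve 3 (λ l Ca Cb → (((l :+ Ca) :- Cb) :- Ca) :+ Cb := l) refl l (C a) (C b) ⟩
        l ∎

module Lists where

  open import Data.Nat.Base using (_≤_; s≤s)
  open import Data.Fin.Base using (zero; suc)
  open import Data.List.Base using (filterᵇ; lookup; take; drop)
  open import Data.List.Properties using (∷-injective; filter-none)
  open import Data.List.Relation.Unary.AllPairs using (AllPairs; []; _∷_)
  import Data.List.Relation.Unary.All as All
  open import Data.Sum.Base using (_⊎_; inj₁; inj₂)

  filter-rejects : ∀ {A : Set} (P : A → Bool) {xs} → All (λ x → P x ≡ false) xs → filterᵇ P xs ≡ []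
  filter-rejects P rejects = filter-none (T? ∘ P) (All.map (λ P≡false → subst T P≡false) rejects)

  filter-split : ∀ {A : Set} (R P Q : A → Bool) {xs : List A} →
    (∀ x → R x ≡ (P x ∨ Q x)) → (∀ x → P x ≡ true → Q x ≡ false) →
    AllPairs (λ x y → Q x ≡ true → P y ≡ false) xs →
    filterᵇ R xs ≡ filterᵇ P xs ++ filterᵇ Q xs
  filter-split R P Q                R≡P∨Q disjoint []                 = refl
  filter-split R P Q {x ∷ xs} R≡P∨Q disjoint (no-P-after ∷ ordered)
    rewrite R≡P∨Q x with P x in Px | Q x in Qx
  ... | true  | true  = contradiction (trans (sym (disjoint x Px)) Qx) (λ ())
  ... | true  | false = cong (x ∷_) (filter-split R P Q R≡P∨Q disjoint ordered)
  ... | false | false = filter-split R P Q R≡P∨Q disjoint ordered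
  ... | false | true
    rewrite filter-split R P Q R≡P∨Q disjoint ordered | filter-rejects P (All.map (_$ refl) no-P-after) = refl

  split-++ : ∀ {A : Set} (as bs xs : List A) y ys → as ++ bs ≡ xs ++ y ∷ ys →
    (Σ (List A) λ ys′ → as ≡ xs ++ y ∷ ys′) ⊎ (Σ (List A) λ xs′ → bs ≡ xs′ ++ y ∷ ys × xs ≡ as ++ xs′)
  split-++ []       bs xs       y ys eq = inj₂ (xs , eq , refl)
  split-++ (a ∷ as) bs []       y ys eq with ∷-injective eq
  ... | refl , _ = inj₁ (as , refl)
  split-++ (a ∷ as) bs (x ∷ xs) y ys eq with ∷-injective eq
  ... | refl , eq′ with split-++ as bs xs y ys eq′
  ...   | inj₁ (ys′ , e)       = inj₁ (ys′ , cong (a ∷_) e)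
  ...   | inj₂ (xs′ , e₁ , e₂) = inj₂ (xs′ , e₁ , cong (a ∷_) e₂)

  AllPairs-universal : ∀ {A : Set} {R : A → A → Set} → (∀ x y → R x y) → ∀ xs → AllPairs R xs
  AllPairs-universal R-all []       = []
  AllPairs-universal R-all (x ∷ xs) = All.universal (R-all x) xs ∷ AllPairs-universal R-all xs

  split-at : ∀ {A : Set} (xs : List A) i → xs ≡ take (toℕ i) xs ++ lookup xs i ∷ drop (suc (toℕ i)) xs
  split-at (x ∷ xs) zero    = refl
  split-at (x ∷ xs) (suc i) = cong (x ∷_) (split-at xs i)

  All-lookup : ∀ {A : Set} {P : A → Set} {xs : List A} → All P xs → ∀ i → P (lookup xs i)
  All-lookup (px ∷ _)   zero    = px
  All-lookup (_  ∷ pxs) (suc i) = All-lookup pxs i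

  AllPairs-lookup : ∀ {A : Set} {R : A → A → Set} → (∀ {x} → R x x) → ∀ {xs : List A} →
    AllPairs R xs → ∀ i j → toℕ i ≤ toℕ j → R (lookup xs i) (lookup xs j)
  AllPairs-lookup R-refl (_ ∷ _)          zero    zero    _         = R-refl
  AllPairs-lookup R-refl (Rx ∷ _)         zero    (suc j) _         = All-lookup Rx j
  AllPairs-lookup R-refl (_ ∷ ordered)    (suc i) (suc j) (s≤s i≤j) = AllPairs-lookup R-refl ordered i j i≤j

module Counting where

  open import Data.Nat.Base using (_+_; _*_; _≤_; _<_; z≤n; s≤s; _≤ᵇ_; _<ᵇ_)
  import Data.Nat.Properties as ℕP
  open import Data.Nat.ListAction using (sum)
  open import Data.Fin.Base using (zero; suc)
  open import Data.List.Base using (map; reverse; filterᵇ; allFin; downFrom; [_]; lookup; length; take)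
  open import Data.List.Relation.Unary.All.Properties using (applyDownFrom⁺₁) renaming (map⁺ to All-map⁺)
  open import Data.Bool.Properties using (∧-identityʳ; ∧-zeroʳ; ∧-comm)
  open import Relation.Binary.Definitions using (Tri; tri<; tri≈; tri>)
  open import Data.List.Properties using (map-tabulate; unfold-reverse)
  import Data.List.Relation.Unary.All as All
  open import Algebra.Properties.CommutativeSemigroup ℕP.+-commutativeSemigroup using (interchange)

  ⟦_⟧ : Bool → ℕ
  ⟦ true ⟧  = 1
  ⟦ false ⟧ = 0

  indicator-∧ : ∀ x y → ⟦ x ⟧ * ⟦ y ⟧ ≡ ⟦ x ∧ y ⟧
  indicator-∧ true  true  = refl
  indicator-∧ true  false = refl
  indicator-∧ false y     = refl

  module _ {A : Set} where

    count-∷ : ∀ (P : A → Bool) x xs → countᵇ P (x ∷ xs) ≡ ⟦ P x ⟧ + countᵇ P xs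
    count-∷ P x xs with P x
    ... | true  = refl
    ... | false = refl

    count-++ : ∀ (P : A → Bool) xs ys → countᵇ P (xs ++ ys) ≡ countᵇ P xs + countᵇ P ys
    count-++ P []       ys = refl
    count-++ P (x ∷ xs) ys = begin
      countᵇ P (x ∷ xs ++ ys)               ≡⟨ count-∷ P x (xs ++ ys) ⟩
      ⟦ P x ⟧ + countᵇ P (xs ++ ys)         ≡⟨ cong (⟦ P x ⟧ +_) (count-++ P xs ys) ⟩
      ⟦ P x ⟧ + (countᵇ P xs + countᵇ P ys) ≡⟨ ℕP.+-assoc ⟦ P x ⟧ _ _ ⟨
      (⟦ P x ⟧ + countᵇ P xs) + countᵇ P ys ≡⟨ cong (_+ countᵇ P ys) (count-∷ P x xs) ⟨
      countᵇ P (x ∷ xs) + countᵇ P ys       ∎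
      where open ≡-Reasoning

    count-congᴬ : ∀ (P Q : A → Bool) {xs} → All (λ x → P x ≡ Q x) xs → countᵇ P xs ≡ countᵇ Q xs
    count-congᴬ P Q []                  = refl
    count-congᴬ P Q {x ∷ xs} (e ∷ es) rewrite count-∷ P x xs | count-∷ Q x xs | e =
      cong (⟦ Q x ⟧ +_) (count-congᴬ P Q es)

    count-cong : ∀ {P Q : A → Bool} → (∀ x → P x ≡ Q x) → ∀ xs → countᵇ P xs ≡ countᵇ Q xs
    count-cong {P} {Q} P≗Q xs = count-congᴬ P Q (All.universal P≗Q xs)

    count-none : ∀ (P : A → Bool) {xs} → All (λ x → P x ≡ false) xs → countᵇ P xs ≡ 0
    count-none P []       = refl
    count-none P (e ∷ es) rewrite e = count-none P es

    count-reverse : ∀ (P : A → Bool) xs → countᵇ P (reverse xs) ≡ countᵇ P xs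
    count-reverse P []       = refl
    count-reverse P (x ∷ xs) = begin
      countᵇ P (reverse (x ∷ xs))           ≡⟨ cong (countᵇ P) (unfold-reverse x xs) ⟩
      countᵇ P (reverse xs ++ [ x ])        ≡⟨ count-++ P (reverse xs) [ x ] ⟩
      countᵇ P (reverse xs) + countᵇ P [ x ] ≡⟨ cong₂ _+_ (count-reverse P xs) (count-∷ P x []) ⟩
      countᵇ P xs + (⟦ P x ⟧ + 0)           ≡⟨ cong (countᵇ P xs +_) (ℕP.+-identityʳ ⟦ P x ⟧) ⟩
      countᵇ P xs + ⟦ P x ⟧                 ≡⟨ ℕP.+-comm (countᵇ P xs) ⟦ P x ⟧ ⟩
      ⟦ P x ⟧ + countᵇ P xs                 ≡⟨ count-∷ P x xs ⟨
      countᵇ P (x ∷ xs)                     ∎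
      where open ≡-Reasoning

    count-filter : ∀ (P Q : A → Bool) xs → countᵇ P (filterᵇ Q xs) ≡ countᵇ (λ x → Q x ∧ P x) xs
    count-filter P Q []       = refl
    count-filter P Q (x ∷ xs) with Q x
    ... | false = count-filter P Q xs
    ... | true with P x
    ...   | true  = cong suc (count-filter P Q xs)
    ...   | false = count-filter P Q xs

    sum-indicator : ∀ (P : A → Bool) xs → sum (map (λ x → ⟦ P x ⟧) xs) ≡ countᵇ P xs
    sum-indicator P []       = refl
    sum-indicator P (x ∷ xs) = trans (cong (⟦ P x ⟧ +_) (sum-indicator P xs)) (sym (count-∷ P x xs))

    sum-+ : ∀ (f g : A → ℕ) xs → sum (map (λ x → f x + g x) xs) ≡ sum (map f xs) + sum (map g xs)
    sum-+ f g []       = refl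
    sum-+ f g (x ∷ xs) rewrite sum-+ f g xs = interchange (f x) (g x) (sum (map f xs)) (sum (map g xs))

  sum-zeros : ∀ {A : Set} (f : A → ℕ) xs → (∀ x → f x ≡ 0) → sum (map f xs) ≡ 0
  sum-zeros f []       f≗0 = refl
  sum-zeros f (x ∷ xs) f≗0 rewrite f≗0 x = sum-zeros f xs f≗0

  count-map : ∀ {A B : Set} (P : B → Bool) (f : A → B) xs → countᵇ P (map f xs) ≡ countᵇ (λ x → P (f x)) xs
  count-map P f []       = refl
  count-map P f (x ∷ xs) with P (f x)
  ... | true  = cong suc (count-map P f xs)
  ... | false = count-map P f xs

  allFin-suc : ∀ m → allFin (suc m) ≡ zero ∷ map suc (allFin m)
  allFin-suc m = cong (zero ∷_) (sym (map-tabulate (λ i → i) suc))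

  count-allFin-suc : ∀ m (P : Fin (suc m) → Bool) →
    countᵇ P (allFin (suc m)) ≡ ⟦ P zero ⟧ + countᵇ (λ i → P (suc i)) (allFin m)
  count-allFin-suc m P = begin
    countᵇ P (allFin (suc m))                          ≡⟨ cong (countᵇ P) (allFin-suc m) ⟩
    countᵇ P (zero ∷ map suc (allFin m))               ≡⟨ count-∷ P zero _ ⟩
    ⟦ P zero ⟧ + countᵇ P (map suc (allFin m))         ≡⟨ cong (⟦ P zero ⟧ +_) (count-map P suc (allFin m)) ⟩
    ⟦ P zero ⟧ + countᵇ (λ i → P (suc i)) (allFin m)   ∎
    where open ≡-Reasoning

  count-at : ∀ {n} (x : Fin n) (Q : Fin n → Bool) → countᵇ (λ i → (i == x) ∧ Q i) (allFin n) ≡ ⟦ Q x ⟧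
  count-at {suc m} zero Q rewrite count-allFin-suc m (λ i → (i == zero) ∧ Q i) =
    trans (cong (⟦ Q zero ⟧ +_) (count-none _ (All.universal (λ _ → refl) (allFin m)))) (ℕP.+-identityʳ _)
  count-at {suc m} (suc x) Q rewrite count-allFin-suc m (λ i → (i == suc x) ∧ Q i) =
    trans (count-cong (λ i → cong (_∧ Q (suc i)) (suc-== i x)) (allFin m)) (count-at x (λ i → Q (suc i)))
    where
    suc-== : ∀ {n} (i x : Fin n) → (Fin.suc i == Fin.suc x) ≡ (i == x)
    suc-== i x with i ≟ x
    ... | yes refl = refl
    ... | no _     = refl

  count-filter-at : ∀ {n} (Q : Fin n → Bool) x → countᵇ (_== x) (filterᵇ Q (allFin n)) ≡ ⟦ Q x ⟧
  count-filter-at Q x = begin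
    countᵇ (_== x) (filterᵇ Q (allFin _))       ≡⟨ count-filter (_== x) Q (allFin _) ⟩
    countᵇ (λ i → Q i ∧ (i == x)) (allFin _)   ≡⟨ count-cong (λ i → ∧-comm (Q i) (i == x)) (allFin _) ⟩
    countᵇ (λ i → (i == x) ∧ Q i) (allFin _)   ≡⟨ count-at x Q ⟩
    ⟦ Q x ⟧                                    ∎
    where open ≡-Reasoning

  closed-fails : ∀ {m} (Q : Fin (suc m) → Bool) →
    (∀ i j → toℕ j ≤ toℕ i → Q i ≡ true → Q j ≡ true) → Q zero ≡ false → ∀ i → Q i ≡ false
  closed-fails Q closed Q0 i with Q i in Qi
  ... | true  = contradiction (trans (sym (closed i zero z≤n Qi)) Q0) (λ ())
  ... | false = refl

  initial-segment : ∀ {n} (Q : Fin n → Bool) →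
    (∀ i j → toℕ j ≤ toℕ i → Q i ≡ true → Q j ≡ true) →
    ∀ a → Q a ≡ (toℕ a <ᵇ countᵇ Q (allFin n))
  initial-segment {suc m} Q closed a rewrite count-allFin-suc m Q with Q zero in Q0
  initial-segment {suc m} Q closed zero    | true = Q0
  initial-segment {suc m} Q closed (suc a) | true =
    initial-segment (λ i → Q (suc i)) (λ i j j≤i → closed (suc i) (suc j) (s≤s j≤i)) a
  initial-segment {suc m} Q closed a       | false
    rewrite count-none (λ i → Q (suc i)) (All.universal (λ i → closed-fails Q closed Q0 (suc i)) (allFin m)) =
    trans (closed-fails Q closed Q0 a) (sym (<ᵇ-false {toℕ a} {0} (λ ())))

  count-prefix : ∀ {A : Set} (G : List A) (P : A → Bool) t →
    countᵇ (λ i → (toℕ i <ᵇ t) ∧ P (lookup G i)) (allFin (length G)) ≡ countᵇ P (take t G)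
  count-prefix []      P zero    = refl
  count-prefix []      P (suc t) = refl
  count-prefix (x ∷ G) P zero    =
    count-none (λ i → (toℕ i <ᵇ 0) ∧ P (lookup (x ∷ G) i))
      (All.universal (λ i → cong (_∧ P (lookup (x ∷ G) i)) (<ᵇ-false {toℕ i} {0} (λ ()))) (allFin (suc (length G))))
  count-prefix (x ∷ G) P (suc t) = begin
    countᵇ (λ i → (toℕ i <ᵇ suc t) ∧ P (lookup (x ∷ G) i)) (allFin (suc (length G)))
      ≡⟨ count-allFin-suc (length G) (λ i → (toℕ i <ᵇ suc t) ∧ P (lookup (x ∷ G) i)) ⟩
    ⟦ P x ⟧ + countᵇ (λ i → (toℕ i <ᵇ t) ∧ P (lookup G i)) (allFin (length G))
      ≡⟨ cong (⟦ P x ⟧ +_) (count-prefix G P t) ⟩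
    ⟦ P x ⟧ + countᵇ P (take t G)
      ≡⟨ count-∷ P x (take t G) ⟨
    countᵇ P (take (suc t) (x ∷ G)) ∎
    where open ≡-Reasoning

  range : ℕ → List ℕ
  range L = map suc (downFrom L)

  range-bounded : ∀ L → All (_≤ L) (range L)
  range-bounded L = All-map⁺ (applyDownFrom⁺₁ (λ i → i) L (λ i<L → i<L))

  columnsFrom : ℕ → ℕ → (ℕ → Bool) → ℕ
  columnsFrom q L F = countᵇ (λ j → (q ≤ᵇ j) ∧ F j) (range L)

  columnsFrom-empty : ∀ q L F → L < q → columnsFrom q L F ≡ 0
  columnsFrom-empty q zero    F _    = refl
  columnsFrom-empty q (suc L) F L<q rewrite ≤ᵇ-false {q} {suc L} (ℕP.<⇒≱ L<q) =
    columnsFrom-empty q L F (ℕP.<-trans (ℕP.n<1+n L) L<q)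

  columnsFrom-step : ∀ r L F →
    columnsFrom (suc r) L F ≡ columnsFrom (suc (suc r)) L F + ⟦ (suc r ≤ᵇ L) ∧ F (suc r) ⟧
  columnsFrom-step r zero    F rewrite <ᵇ-false {r} {0} (λ ()) = refl
  columnsFrom-step r (suc L) F = begin
    columnsFrom (suc r) (suc L) F
      ≡⟨ count-∷ _ (suc L) (range L) ⟩
    ⟦ (r <ᵇ suc L) ∧ F (suc L) ⟧ + columnsFrom (suc r) L F
      ≡⟨ cong (⟦ (r <ᵇ suc L) ∧ F (suc L) ⟧ +_) (columnsFrom-step r L F) ⟩
    ⟦ (r <ᵇ suc L) ∧ F (suc L) ⟧ + (c + ⟦ (r <ᵇ L) ∧ F (suc r) ⟧)
      ≡⟨ by-position (ℕP.<-cmp r L) ⟩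
    (⟦ (r <ᵇ L) ∧ F (suc L) ⟧ + c) + ⟦ (r <ᵇ suc L) ∧ F (suc r) ⟧
      ≡⟨ cong (_+ ⟦ (r <ᵇ suc L) ∧ F (suc r) ⟧) (count-∷ _ (suc L) (range L)) ⟨
    columnsFrom (suc (suc r)) (suc L) F + ⟦ (suc r ≤ᵇ suc L) ∧ F (suc r) ⟧ ∎
    where
    open ≡-Reasoning
    c = columnsFrom (suc (suc r)) L F
    by-position : Tri (r < L) (r ≡ L) (L < r) →
      ⟦ (r <ᵇ suc L) ∧ F (suc L) ⟧ + (c + ⟦ (r <ᵇ L) ∧ F (suc r) ⟧)
        ≡ (⟦ (r <ᵇ L) ∧ F (suc L) ⟧ + c) + ⟦ (r <ᵇ suc L) ∧ F (suc r) ⟧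
    by-position (tri< r<L _ _) rewrite <ᵇ-true r<L | <ᵇ-true (ℕP.m<n⇒m<1+n r<L) =
      sym (ℕP.+-assoc ⟦ F (suc L) ⟧ c ⟦ F (suc r) ⟧)
    by-position (tri≈ _ refl _) rewrite <ᵇ-false (ℕP.n≮n r) | <ᵇ-true (ℕP.n<1+n r) =
      trans (cong (⟦ F (suc r) ⟧ +_) (ℕP.+-identityʳ c)) (ℕP.+-comm ⟦ F (suc r) ⟧ c)
    by-position (tri> _ _ L<r) rewrite <ᵇ-false (ℕP.<⇒≯ L<r) | <ᵇ-false {r} {suc L} (λ r<1+L → ℕP.<⇒≱ L<r (ℕP.<⇒≤pred r<1+L)) =
      refl

  restrict-columns : ∀ (P : ℕ → Bool) A L → A ≤ L →
    countᵇ (λ j → P j ∧ (j ≤ᵇ A)) (range L) ≡ countᵇ P (range A)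
  restrict-columns P A zero    z≤n = refl
  restrict-columns P A (suc L) A≤1+L with A ℕP.≟ suc L
  ... | yes refl = count-congᴬ _ P (All.map (λ {j} j≤A → trans (cong (P j ∧_) (≤ᵇ-true j≤A)) (∧-identityʳ (P j)))
                                            (range-bounded (suc L)))
  ... | no A≢1+L rewrite ≤ᵇ-false {suc L} {A} (λ 1+L≤A → A≢1+L (ℕP.≤-antisym A≤1+L 1+L≤A)) | ∧-zeroʳ (P (suc L)) =
    restrict-columns P A L (ℕP.≤-pred (ℕP.≤∧≢⇒< A≤1+L A≢1+L))

module Chain {n : ℕ} (la : Partition n) where

  open Counting
  open Lists
  open import Data.Nat.Base using (_+_; _*_; _≤_; _<_; z≤n; s≤s; _≤ᵇ_; _<ᵇ_)
  import Data.Nat.Properties as ℕP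
  open import Data.Fin.Base using (zero; suc)
  open import Data.List.Base using (map; filterᵇ; reverse; allFin; concatMap; lookup; length; take; drop; [_])
  open import Data.List.Properties using (++-assoc; take-suc)
  import Data.List.Relation.Unary.All as All
  open import Data.List.Relation.Unary.All.Properties using (all-filter; ++⁺; ++⁻ʳ)
    renaming (map⁺ to All-map⁺)
  open import Data.List.Relation.Unary.AllPairs using (AllPairs; []; _∷_)
  import Data.List.Relation.Unary.AllPairs.Properties as AllPairs
  open import Data.List.Relation.Unary.Any.Properties using (reverse⁻)
  open import Data.Bool.Properties using (∧-identityʳ)
  open import Data.Sum.Base using (inj₁; inj₂)

  row-bounded : ∀ a → parts la a ≤ λ₁ la
  row-bounded = bounded la
    where
    bounded : ∀ {n} (la : Partition n) a → parts la a ≤ λ₁ la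
    bounded {suc _} la a = ℕP.≤-trans (antitone la zero a z≤n) (ℕP.m≤m⊔n (parts la zero) _)

  K : ℕ → ℕ
  K = conj la

  isPair : Fin n → Fin n → Fin n × Fin n → Bool
  isPair a b e = (proj₁ e == a) ∧ (proj₂ e == b)

  count-pairs : ∀ a b (As Bs : List (Fin n)) →
    countᵇ (isPair a b) (concatMap (λ a′ → map (a′ ,_) Bs) As) ≡ countᵇ (_== a) As * countᵇ (_== b) Bs
  count-pairs a b []        Bs = refl
  count-pairs a b (a′ ∷ As) Bs = begin
    countᵇ (isPair a b) (map (a′ ,_) Bs ++ concatMap (λ a′ → map (a′ ,_) Bs) As)
      ≡⟨ count-++ (isPair a b) (map (a′ ,_) Bs) _ ⟩
    countᵇ (isPair a b) (map (a′ ,_) Bs) + countᵇ (isPair a b) (concatMap (λ a′ → map (a′ ,_) Bs) As)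
      ≡⟨ cong₂ _+_ (trans (count-map (isPair a b) (a′ ,_) Bs) (row (a′ == a))) (count-pairs a b As Bs) ⟩
    ⟦ a′ == a ⟧ * countᵇ (_== b) Bs + countᵇ (_== a) As * countᵇ (_== b) Bs
      ≡⟨ ℕP.*-distribʳ-+ (countᵇ (_== b) Bs) ⟦ a′ == a ⟧ _ ⟨
    (⟦ a′ == a ⟧ + countᵇ (_== a) As) * countᵇ (_== b) Bs
      ≡⟨ cong (_* countᵇ (_== b) Bs) (count-∷ (_== a) a′ As) ⟨
    countᵇ (_== a) (a′ ∷ As) * countᵇ (_== b) Bs ∎
    where
    open ≡-Reasoning
    row : ∀ c → countᵇ (λ b′ → c ∧ (b′ == b)) Bs ≡ ⟦ c ⟧ * countᵇ (_== b) Bs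
    row true  = sym (ℕP.+-identityʳ _)
    row false = count-none _ (All.universal (λ _ → refl) Bs)

  Γk-count : ∀ k a b → countᵇ (isPair a b) (Γk n k) ≡ ⟦ (toℕ a <ᵇ k) ∧ (k ≤ᵇ toℕ b) ⟧
  Γk-count k a b = begin
    countᵇ (isPair a b) (Γk n k)
      ≡⟨ count-pairs a b As Bs ⟩
    countᵇ (_== a) As * countᵇ (_== b) Bs
      ≡⟨ cong₂ _*_ (count-filter-at (λ a′ → toℕ a′ <ᵇ k) a)
                   (trans (count-reverse (_== b) (filterᵇ (λ b′ → k ≤ᵇ toℕ b′) (allFin n))) (count-filter-at (λ b′ → k ≤ᵇ toℕ b′) b)) ⟩
    ⟦ toℕ a <ᵇ k ⟧ * ⟦ k ≤ᵇ toℕ b ⟧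
      ≡⟨ indicator-∧ (toℕ a <ᵇ k) (k ≤ᵇ toℕ b) ⟩
    ⟦ (toℕ a <ᵇ k) ∧ (k ≤ᵇ toℕ b) ⟧ ∎
    where
    open ≡-Reasoning
    As = filterᵇ (λ a′ → toℕ a′ <ᵇ k) (allFin n)
    Bs = reverse (filterᵇ (λ b′ → k ≤ᵇ toℕ b′) (allFin n))

  Γk-entries : ∀ k → All (λ e → toℕ (proj₁ e) < k × k ≤ toℕ (proj₂ e)) (Γk n k)
  Γk-entries k = concat-entries (all-filter _ (allFin n))
    where
    Bs = reverse (filterᵇ (λ b′ → k ≤ᵇ toℕ b′) (allFin n))
    Bs-entries : All (λ b′ → k ≤ toℕ b′) Bs
    Bs-entries = All.tabulate (λ b′∈Bs → ≤ᵇ-sound (T-true (All.lookup (all-filter _ (allFin n)) (reverse⁻ b′∈Bs))))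
    concat-entries : ∀ {As} → All (λ a′ → T (toℕ a′ <ᵇ k)) As →
      All (λ e → toℕ (proj₁ e) < k × k ≤ toℕ (proj₂ e)) (concatMap (λ a′ → map (a′ ,_) Bs) As)
    concat-entries []               = []
    concat-entries (a′<k ∷ As<k) =
      ++⁺ (All-map⁺ (All.map (λ k≤b′ → <ᵇ-sound (T-true a′<k) , k≤b′) Bs-entries)) (concat-entries As<k)

  -- entries of Γ tagged by the index j of their segment; the tagged segment Γ_j and the
  -- first L segments Γ_L ⋯ Γ_1, so that Γtagged la is chain (λ₁ la)
  Entry : Set
  Entry = ℕ × (Fin n × Fin n)

  segment : ℕ → List Entry
  segment j = map (j ,_) (Γk n (K j))

  chain : ℕ → List Entry
  chain L = concatMap segment (range L)

  segment-tagged : ∀ j → All (λ (i , a , b) → i ≡ j × toℕ a < K j × K j ≤ toℕ b) (segment j)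
  segment-tagged j = All-map⁺ (All.map (λ (a<K , K≤b) → refl , a<K , K≤b) (Γk-entries (K j)))

  WellTagged : ℕ → Entry → Set
  WellTagged L (j , a , b) = 1 ≤ j × j ≤ L × toℕ a < K j × K j ≤ toℕ b

  chain-tagged : ∀ L → All (WellTagged L) (chain L)
  chain-tagged zero    = []
  chain-tagged (suc L) =
    ++⁺ (All.map (λ { (refl , a<K , K≤b) → s≤s z≤n , ℕP.≤-refl , a<K , K≤b }) (segment-tagged (suc L)))
        (All.map (λ (1≤j , j≤L , a<K , K≤b) → 1≤j , ℕP.m≤n⇒m≤1+n j≤L , a<K , K≤b) (chain-tagged L))

  chain-descending : ∀ L → AllPairs (λ x y → proj₁ y ≤ proj₁ x) (chain L)
  chain-descending zero    = []
  chain-descending (suc L) =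
    AllPairs.++⁺ (AllPairs.map⁺ (AllPairs-universal (λ _ _ → ℕP.≤-refl) (Γk n (K (suc L)))))
                 (chain-descending L)
                 (All-map⁺ (All.universal (λ _ → All.map (λ t → ℕP.m≤n⇒m≤1+n (proj₁ (proj₂ t))) (chain-tagged L)) _))

  occurrences : ℕ → ℕ → Fin n → Fin n → ℕ
  occurrences L q a b = columnsFrom q L (λ j → (toℕ a <ᵇ K j) ∧ (K j ≤ᵇ toℕ b))

  occurrences-suc : ∀ L q a b → occurrences (suc L) q a b
    ≡ ⟦ (q ≤ᵇ suc L) ∧ ((toℕ a <ᵇ K (suc L)) ∧ (K (suc L) ≤ᵇ toℕ b)) ⟧ + occurrences L q a b
  occurrences-suc L q a b = count-∷ _ (suc L) (range L)

  segment-count : ∀ j a b →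
    countᵇ (λ e → isPair a b (proj₂ e)) (segment j) ≡ ⟦ (toℕ a <ᵇ K j) ∧ (K j ≤ᵇ toℕ b) ⟧
  segment-count j a b = trans (count-map (λ e → isPair a b (proj₂ e)) (j ,_) (Γk n (K j))) (Γk-count (K j) a b)

  occurrences-upto : ∀ L xs q a b ys → chain L ≡ xs ++ (q , a , b) ∷ ys →
    countᵇ (λ e → isPair a b (proj₂ e)) (xs ++ [ (q , a , b) ]) ≡ occurrences L q a b
  occurrences-upto zero    []      q a b ys ()
  occurrences-upto zero    (_ ∷ _) q a b ys ()
  occurrences-upto (suc L) xs q a b ys eq with split-++ (segment (suc L)) (chain L) xs (q , a , b) ys eq
  ... | inj₁ (ys′ , in-segment)
    with ++⁻ʳ xs (subst (All _) in-segment (segment-tagged (suc L)))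
  ...   | (refl , a<K , K≤b) ∷ _ = trans once (sym (trans (occurrences-suc L (suc L) a b) (cong₂ _+_ first-segment rest-empty)))
    where
    P = λ (e : Entry) → isPair a b (proj₂ e)
    y = (suc L , a , b)
    in-Γ : (toℕ a <ᵇ K (suc L)) ∧ (K (suc L) ≤ᵇ toℕ b) ≡ true
    in-Γ rewrite <ᵇ-true a<K | ≤ᵇ-true K≤b = refl
    at-y : countᵇ P [ y ] ≡ 1
    at-y rewrite ==-refl a | ==-refl b = refl
    at-most-once : countᵇ P (xs ++ [ y ]) ≤ 1
    at-most-once = begin
      countᵇ P (xs ++ [ y ])                    ≤⟨ ℕP.m≤m+n _ _ ⟩
      countᵇ P (xs ++ [ y ]) + countᵇ P ys′     ≡⟨ count-++ P (xs ++ [ y ]) ys′ ⟨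
      countᵇ P ((xs ++ [ y ]) ++ ys′)           ≡⟨ cong (countᵇ P) (trans (++-assoc xs [ y ] ys′) (sym in-segment)) ⟩
      countᵇ P (segment (suc L))                ≡⟨ trans (segment-count (suc L) a b) (cong ⟦_⟧ in-Γ) ⟩
      1                                         ∎
      where open ℕP.≤-Reasoning
    at-least-once : 1 ≤ countᵇ P (xs ++ [ y ])
    at-least-once = begin
      1                                         ≡⟨ at-y ⟨
      countᵇ P [ y ]                            ≤⟨ ℕP.m≤n+m _ _ ⟩
      countᵇ P xs + countᵇ P [ y ]              ≡⟨ count-++ P xs [ y ] ⟨
      countᵇ P (xs ++ [ y ])                    ∎
      where open ℕP.≤-Reasoning
    once : countᵇ P (xs ++ [ y ]) ≡ 1
    once = ℕP.≤-antisym at-most-once at-least-once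
    first-segment : ⟦ (suc L ≤ᵇ suc L) ∧ ((toℕ a <ᵇ K (suc L)) ∧ (K (suc L) ≤ᵇ toℕ b)) ⟧ ≡ 1
    first-segment rewrite ≤ᵇ-true (ℕP.≤-refl {suc L}) | in-Γ = refl
    rest-empty : occurrences L (suc L) a b ≡ 0
    rest-empty = columnsFrom-empty (suc L) L _ (ℕP.n<1+n L)
  occurrences-upto (suc L) xs q a b ys eq | inj₂ (xs′ , in-rest , refl)
    with ++⁻ʳ xs′ (subst (All _) in-rest (chain-tagged L))
  ...   | (_ , q≤L , _) ∷ _ = begin
    countᵇ P ((segment (suc L) ++ xs′) ++ [ y ])
      ≡⟨ cong (countᵇ P) (++-assoc (segment (suc L)) xs′ [ y ]) ⟩
    countᵇ P (segment (suc L) ++ (xs′ ++ [ y ]))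
      ≡⟨ count-++ P (segment (suc L)) (xs′ ++ [ y ]) ⟩
    countᵇ P (segment (suc L)) + countᵇ P (xs′ ++ [ y ])
      ≡⟨ cong₂ _+_ (segment-count (suc L) a b) (occurrences-upto L xs′ q a b ys in-rest) ⟩
    ⟦ (toℕ a <ᵇ K (suc L)) ∧ (K (suc L) ≤ᵇ toℕ b) ⟧ + occurrences L q a b
      ≡⟨ cong (λ c → ⟦ c ∧ ((toℕ a <ᵇ K (suc L)) ∧ (K (suc L) ≤ᵇ toℕ b)) ⟧ + occurrences L q a b)
              (≤ᵇ-true (ℕP.m≤n⇒m≤1+n q≤L)) ⟨
    ⟦ (q ≤ᵇ suc L) ∧ ((toℕ a <ᵇ K (suc L)) ∧ (K (suc L) ≤ᵇ toℕ b)) ⟧ + occurrences L q a b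
      ≡⟨ occurrences-suc L q a b ⟨
    occurrences (suc L) q a b ∎
    where
    open ≡-Reasoning
    P = λ (e : Entry) → isPair a b (proj₂ e)
    y = (q , a , b)

  lev-occurrences : ∀ p → lev la p ≡ occurrences (λ₁ la) (seg la p) (proj₁ (β la p)) (proj₂ (β la p))
  lev-occurrences p = begin
    lev la p
      ≡⟨ count-cong (λ i → cong (_∧ P (lookup G i)) (≤ᵇ-as-<ᵇ (toℕ i) (toℕ p))) (allFin (length G)) ⟩
    countᵇ (λ i → (toℕ i <ᵇ suc (toℕ p)) ∧ P (lookup G i)) (allFin (length G))
      ≡⟨ count-prefix G P (suc (toℕ p)) ⟩
    countᵇ P (take (suc (toℕ p)) G)
      ≡⟨ cong (countᵇ P) (take-suc G p) ⟩
    countᵇ P (take (toℕ p) G ++ [ lookup G p ])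
      ≡⟨ occurrences-upto (λ₁ la) (take (toℕ p) G) (seg la p) a b (drop (suc (toℕ p)) G) (split-at G p) ⟩
    occurrences (λ₁ la) (seg la p) a b ∎
    where
    open ≡-Reasoning
    G = Γtagged la
    a = proj₁ (β la p)
    b = proj₂ (β la p)
    P = λ (e : Entry) → isPair a b (proj₂ e)

  seg-antitone : ∀ p p′ → toℕ p ≤ toℕ p′ → seg la p′ ≤ seg la p
  seg-antitone = AllPairs-lookup ℕP.≤-refl (chain-descending (λ₁ la))

  entry-tagged : ∀ p → WellTagged (λ₁ la) (lookup (Γtagged la) p)
  entry-tagged = All-lookup (chain-tagged (λ₁ la))

  conj-char : ∀ j a → (toℕ a <ᵇ K j) ≡ (j ≤ᵇ parts la a)
  conj-char j a = sym (initial-segment (λ i → j ≤ᵇ parts la i) reaches-down a)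
    where
    reaches-down : ∀ i i′ → toℕ i′ ≤ toℕ i → (j ≤ᵇ parts la i) ≡ true → (j ≤ᵇ parts la i′) ≡ true
    reaches-down i i′ i′≤i j≤λi = ≤ᵇ-true (ℕP.≤-trans (≤ᵇ-sound {j} j≤λi) (antitone la i′ i i′≤i))

  seg-beyond-b : ∀ p → parts la (proj₂ (β la p)) < seg la p
  seg-beyond-b p with entry-tagged p
  ... | (_ , _ , _ , K≤b) = ℕP.≰⇒> (λ q≤λb →
    ℕP.<⇒≱ (<ᵇ-sound (trans (conj-char (seg la p) (proj₂ (β la p))) (≤ᵇ-true q≤λb))) K≤b)

  cellsFrom : ℕ → Fin n → ℕ
  cellsFrom q z = columnsFrom q (parts la z) (λ _ → true)

  -- the vector of these cell numbers lies on H_{β_p, l_p} when q is the segment of p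
  lev-shape : ∀ p → cellsFrom (seg la p) (proj₁ (β la p)) ≡ cellsFrom (seg la p) (proj₂ (β la p)) + lev la p
  lev-shape p = begin
    cellsFrom q a
      ≡⟨ restrict-columns (λ j → (q ≤ᵇ j) ∧ true) (parts la a) (λ₁ la) (row-bounded a) ⟨
    countᵇ (λ j → ((q ≤ᵇ j) ∧ true) ∧ (j ≤ᵇ parts la a)) (range (λ₁ la))
      ≡⟨ count-cong rows-in-segments (range (λ₁ la)) ⟨
    occurrences (λ₁ la) q a b
      ≡⟨ lev-occurrences p ⟨
    lev la p
      ≡⟨ cong (_+ lev la p) (columnsFrom-empty q (parts la b) _ (seg-beyond-b p)) ⟨
    cellsFrom q b + lev la p ∎
    where
    open ≡-Reasoning
    q = seg la p
    a = proj₁ (β la p)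
    b = proj₂ (β la p)
    K≤b : ∀ j → q ≤ j → K j ≤ toℕ b
    K≤b j q≤j = ℕP.≮⇒≥ (λ b<K → ℕP.<⇒≱ (seg-beyond-b p)
                   (ℕP.≤-trans q≤j (≤ᵇ-sound (trans (sym (conj-char j b)) (<ᵇ-true b<K)))))
    -- for j ≥ q > λ_b, the pair (a, b) lies in Γ_j exactly when row a reaches column j
    rows-in-segments : ∀ j → (q ≤ᵇ j) ∧ ((toℕ a <ᵇ K j) ∧ (K j ≤ᵇ toℕ b)) ≡ ((q ≤ᵇ j) ∧ true) ∧ (j ≤ᵇ parts la a)
    rows-in-segments j with q ≤ᵇ j in q≤j
    ... | false = refl
    ... | true rewrite conj-char j a | ≤ᵇ-true (K≤b j (≤ᵇ-sound q≤j)) = ∧-identityʳ (j ≤ᵇ parts la a)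

module Filling {n : ℕ} (la : Partition n) (w : Permutation′ n) (J : Subset (len la)) where

  open Chain la
  open Counting
  open Lists
  open Affine
  open import Data.Nat.Base using (_≤_; _<_; s≤s; _≤ᵇ_; _<ᵇ_; _≡ᵇ_)
  import Data.Nat.Base as ℕ
  import Data.Nat.Properties as ℕP
  open import Data.Nat.ListAction using (sum)
  open import Data.Rational.Base using (_+_; _-_)
  open import Data.Rational.Properties using (+-assoc; +-identityʳ)
  open import Data.Rational.Solver using (module +-*-Solver)
  open +-*-Solver using (solve; _:+_; _:-_; _:=_)
  open import Data.List.Base using (map; filterᵇ; allFin)
  open import Data.List.Properties using (map-cong)
  import Data.List.Relation.Unary.All as All
  open import Data.List.Relation.Unary.All.Properties using (all-filter)
  open import Data.List.Relation.Unary.AllPairs.Properties using (tabulate⁺-<)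
  open import Data.Bool.Properties using (∧-identityʳ; ∧-zeroʳ; ∧-comm)

  m : ℕ
  m = len la

  A B : Fin m → Fin n
  A p = proj₁ (β la p)
  B p = proj₂ (β la p)

  -- the two letters of β_p differ, so the reflections r̂_p in H_{β_p, l_p} (which are the
  -- affRefl la p of the statement) form a family of affine reflections of type A
  distinct : ∀ p → A p ≢ B p
  distinct p A≡B with entry-tagged p
  ... | (_ , _ , a<K , K≤b) = ℕP.<-irrefl (cong toℕ A≡B) (ℕP.<-≤-trans a<K K≤b)

  open Reflections A B (λ p → ι (ℤ.+ lev la p)) distinct public

  shapeContent : ℕ → Fin n → ℚ
  shapeContent q z = ι (ℤ.+ cellsFrom q z)

  content : ℕ → Fin n → ℚ
  content q e = ι (ℤ.+ Ncount la w J q e)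

  shape-on-H : ∀ q p → seg la p ≡ q → shapeContent q (A p) ≡ shapeContent q (B p) + ι (ℤ.+ lev la p)
  shape-on-H _ p refl = trans (cong (λ c → ι (ℤ.+ c)) (lev-shape p)) (ι-+ (ℤ.+ cellsFrom (seg la p) (B p)) (ℤ.+ lev la p))

  -- "w r̂_{ps} sends ρ_q to θ_q", written through the affine decomposition of r̂_{ps}
  Sends : ℕ → List (Fin m) → Set
  Sends q ps = ∀ x → content q (w ⟨$⟩ʳ swapAll ps x) ≡ shapeContent q x + translation ps x

  -- reflections of the segment Γ_q may be appended: they fix ρ_q
  sends-extend : ∀ q ps S → All (λ p → seg la p ≡ q) S → Sends q ps → Sends q (ps ++ S)
  sends-extend q ps S in-Γq sends x = begin
    content q (w ⟨$⟩ʳ swapAll (ps ++ S) x)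
      ≡⟨ cong (λ y → content q (w ⟨$⟩ʳ y)) (swapAll-++ ps S x) ⟩
    content q (w ⟨$⟩ʳ swapAll ps (swapAll S x))
      ≡⟨ sends (swapAll S x) ⟩
    shapeContent q (swapAll S x) + translation ps (swapAll S x)
      ≡⟨ cong (_+ translation ps (swapAll S x))
              (invariant-shift S {shapeContent q} (All.map (λ {p} → shape-on-H q p) in-Γq) x) ⟩
    (shapeContent q x + translation S x) + translation ps (swapAll S x)
      ≡⟨ +-assoc (shapeContent q x) _ _ ⟩
    shapeContent q x + (translation S x + translation ps (swapAll S x))
      ≡⟨ cong (shapeContent q x +_) (translation-++ ps S x) ⟨
    shapeContent q x + translation (ps ++ S) x ∎
    where open ≡-Reasoning

  moved : List (Fin m) → Fin n → Fin n
  moved ps x = w ⟨$⟩ʳ swapAll ps x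

  unmoved : List (Fin m) → Fin n → Fin n
  unmoved ps y = unswap ps (w ⟨$⟩ˡ y)

  moved-unmoved : ∀ ps y → moved ps (unmoved ps y) ≡ y
  moved-unmoved ps y = trans (cong (w ⟨$⟩ʳ_) (swapAll-unswap ps (w ⟨$⟩ˡ y))) (inverseʳ w)

  moved-injective : ∀ ps {x y} → moved ps x ≡ moved ps y → x ≡ y
  moved-injective ps {x} {y} e =
    swapAll-injective ps (trans (sym (inverseˡ w)) (trans (cong (w ⟨$⟩ˡ_) e) (inverseˡ w)))

  -- column q of σ is filled by π_q = moved (Jabove q), so it contains π_q x once
  -- if row x reaches column q and not at all otherwise
  column-at : ∀ q x → countᵇ (λ i → (q ≤ᵇ parts la i) ∧ (filling la w J i q == filling la w J x q)) (allFin n)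
                      ≡ ⟦ q ≤ᵇ parts la x ⟧
  column-at q x = begin
    countᵇ (λ i → (q ≤ᵇ parts la i) ∧ (π la w J q i == π la w J q x)) (allFin n)
      ≡⟨ count-cong (λ i → trans (cong ((q ≤ᵇ parts la i) ∧_) (π-== i)) (∧-comm (q ≤ᵇ parts la i) (i == x))) (allFin n) ⟩
    countᵇ (λ i → (i == x) ∧ (q ≤ᵇ parts la i)) (allFin n)
      ≡⟨ count-at x (λ i → q ≤ᵇ parts la i) ⟩
    ⟦ q ≤ᵇ parts la x ⟧ ∎
    where
    open ≡-Reasoning
    π-== : ∀ i → (π la w J q i == π la w J q x) ≡ (i == x)
    π-== i with i ≟ x
    ... | yes refl = ==-refl (π la w J q i)
    ... | no i≢x   = ==-≢ (λ e → i≢x (moved-injective (Jabove la J q) e))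

  Ncount-column : ∀ r e → Ncount la w J (suc r) e ≡
    Ncount la w J (suc (suc r)) e ℕ.+ countᵇ (λ i → (suc r ≤ᵇ parts la i) ∧ (filling la w J i (suc r) == e)) (allFin n)
  Ncount-column r e = begin
    sum (map (λ i → columnsFrom (suc r) (parts la i) (F i)) (allFin n))
      ≡⟨ cong sum (map-cong (λ i → columnsFrom-step r (parts la i) (F i)) (allFin n)) ⟩
    sum (map (λ i → columnsFrom (suc (suc r)) (parts la i) (F i) ℕ.+ ⟦ (suc r ≤ᵇ parts la i) ∧ F i (suc r) ⟧) (allFin n))
      ≡⟨ sum-+ _ (λ i → ⟦ (suc r ≤ᵇ parts la i) ∧ F i (suc r) ⟧) (allFin n) ⟩
    Ncount la w J (suc (suc r)) e ℕ.+ sum (map (λ i → ⟦ (suc r ≤ᵇ parts la i) ∧ F i (suc r) ⟧) (allFin n))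
      ≡⟨ cong (Ncount la w J (suc (suc r)) e ℕ.+_) (sum-indicator _ (allFin n)) ⟩
    Ncount la w J (suc (suc r)) e ℕ.+ countᵇ (λ i → (suc r ≤ᵇ parts la i) ∧ F i (suc r)) (allFin n) ∎
    where
    open ≡-Reasoning
    F : Fin n → ℕ → Bool
    F i j = filling la w J i j == e

  content-column : ∀ r x → content (suc r) (π la w J (suc r) x)
                           ≡ content (suc (suc r)) (π la w J (suc r) x) + ι (ℤ.+ ⟦ suc r ≤ᵇ parts la x ⟧)
  content-column r x = trans (cong (λ c → ι (ℤ.+ c)) (trans (Ncount-column r y) (cong (N ℕ.+_) (column-at (suc r) x))))
                             (ι-+ (ℤ.+ N) (ℤ.+ ⟦ suc r ≤ᵇ parts la x ⟧))
    where
    y = π la w J (suc r) x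
    N = Ncount la w J (suc (suc r)) y

  shape-column : ∀ r x → shapeContent (suc r) x ≡ shapeContent (suc (suc r)) x + ι (ℤ.+ ⟦ suc r ≤ᵇ parts la x ⟧)
  shape-column r x = trans (cong (λ c → ι (ℤ.+ c))
                                 (trans (columnsFrom-step r (parts la x) (λ _ → true))
                                        (cong (λ b → cellsFrom (suc (suc r)) x ℕ.+ ⟦ b ⟧) (∧-identityʳ _))))
                           (ι-+ (ℤ.+ cellsFrom (suc (suc r)) x) (ℤ.+ ⟦ suc r ≤ᵇ parts la x ⟧))

  sends-lower : ∀ r → Sends (suc (suc r)) (Jabove la J (suc r)) → Sends (suc r) (Jabove la J (suc r))
  sends-lower r sends x = begin
    content (suc r) (π la w J (suc r) x)
      ≡⟨ content-column r x ⟩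
    content (suc (suc r)) (π la w J (suc r) x) + d
      ≡⟨ cong (_+ d) (sends x) ⟩
    (shapeContent (suc (suc r)) x + t) + d
      ≡⟨ solve 3 (λ s t d → (s :+ t) :+ d := (s :+ d) :+ t) refl (shapeContent (suc (suc r)) x) t d ⟩
    (shapeContent (suc (suc r)) x + d) + t
      ≡⟨ cong (_+ t) (shape-column r x) ⟨
    shapeContent (suc r) x + t ∎
    where
    open ≡-Reasoning
    t = translation (Jabove la J (suc r)) x
    d = ι (ℤ.+ ⟦ suc r ≤ᵇ parts la x ⟧)

  above-top-empty : Jabove la J (suc (λ₁ la)) ≡ []
  above-top-empty = filter-rejects _ (All.universal (λ p →
    trans (cong (inJ la J p ∧_) (<ᵇ-false (ℕP.≤⇒≯ (ℕP.m≤n⇒m≤1+n (proj₁ (proj₂ (entry-tagged p)))))))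
          (∧-zeroʳ _)) (allFin m))

  sends-top : Sends (suc (λ₁ la)) []
  sends-top x = begin
    content (suc (λ₁ la)) (w ⟨$⟩ʳ x)
      ≡⟨ cong (λ c → ι (ℤ.+ c)) (sum-zeros _ (allFin n) (λ i → columnsFrom-empty _ (parts la i) _ (beyond i))) ⟩
    ι (ℤ.+ 0)
      ≡⟨ +-identityʳ (ι (ℤ.+ 0)) ⟨
    ι (ℤ.+ 0) + 0ℚ
      ≡⟨ cong (λ c → ι (ℤ.+ c) + 0ℚ) (columnsFrom-empty _ (parts la x) _ (beyond x)) ⟨
    shapeContent (suc (λ₁ la)) x + 0ℚ ∎
    where
    open ≡-Reasoning
    beyond : ∀ i → parts la i < suc (λ₁ la)
    beyond i = s≤s (row-bounded i)

  inSegment : ℕ → List (Fin m)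
  inSegment q = filterᵇ (λ p → inJ la J p ∧ (seg la p ≡ᵇ q)) (allFin m)

  earlier : Fin m → List (Fin m)
  earlier k = filterᵇ (λ p → inJ la J p ∧ ((seg la p ≡ᵇ seg la k) ∧ (toℕ p <ᵇ toℕ k))) (allFin m)

  inSegment-seg : ∀ q → All (λ p → seg la p ≡ q) (inSegment q)
  inSegment-seg q = All.map (λ {p} t → ℕP.≡ᵇ⇒≡ (seg la p) q (proj₂ (T-∧⁻ {inJ la J p} t))) (all-filter _ (allFin m))

  earlier-seg : ∀ k → All (λ p → seg la p ≡ seg la k) (earlier k)
  earlier-seg k = All.map (λ {p} t → ℕP.≡ᵇ⇒≡ (seg la p) (seg la k) (proj₁ (T-∧⁻ (proj₂ (T-∧⁻ {inJ la J p} t)))))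
                          (all-filter _ (allFin m))

  above-split : ∀ q → Jabove la J q ≡ Jabove la J (suc q) ++ inSegment (suc q)
  above-split q = filter-split _ _ _ splits disjoint (tabulate⁺-< ordered)
    where
    splits : ∀ p → (inJ la J p ∧ (q <ᵇ seg la p))
                   ≡ ((inJ la J p ∧ (suc q <ᵇ seg la p)) ∨ (inJ la J p ∧ (seg la p ≡ᵇ suc q)))
    splits p with inJ la J p
    ... | true  = <ᵇ-split q (seg la p)
    ... | false = refl
    disjoint : ∀ p → (inJ la J p ∧ (suc q <ᵇ seg la p)) ≡ true → (inJ la J p ∧ (seg la p ≡ᵇ suc q)) ≡ false
    disjoint p beyond with inJ la J p
    ... | true  = T-false (λ t → ℕP.<-irrefl (sym (ℕP.≡ᵇ⇒≡ (seg la p) (suc q) t)) (<ᵇ-sound {suc q} {seg la p} beyond))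
    ... | false = refl
    ordered : ∀ {p p′ : Fin m} → toℕ p < toℕ p′ →
      (inJ la J p ∧ (seg la p ≡ᵇ suc q)) ≡ true → (inJ la J p′ ∧ (suc q <ᵇ seg la p′)) ≡ false
    ordered {p} {p′} p<p′ in-seg = trans (cong (inJ la J p′ ∧_) (<ᵇ-false (ℕP.≤⇒≯ seg≤))) (∧-zeroʳ _)
      where
      seg≤ : seg la p′ ≤ suc q
      seg≤ = subst (seg la p′ ≤_) (ℕP.≡ᵇ⇒≡ _ _ (proj₂ (T-∧⁻ {inJ la J p} (true-T in-seg))))
                   (seg-antitone p p′ (ℕP.<⇒≤ p<p′))

  below-split : ∀ k → Jbelow la J k ≡ Jabove la J (seg la k) ++ earlier k
  below-split k = filter-split _ _ _ splits disjoint (tabulate⁺-< ordered)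
    where
    q = seg la k
    splits : ∀ p → (inJ la J p ∧ (toℕ p <ᵇ toℕ k))
                   ≡ ((inJ la J p ∧ (q <ᵇ seg la p)) ∨ (inJ la J p ∧ ((seg la p ≡ᵇ q) ∧ (toℕ p <ᵇ toℕ k))))
    splits p with inJ la J p
    ... | false = refl
    ... | true  = by-position (toℕ p ℕP.<? toℕ k)
      where
      by-position : Dec (toℕ p < toℕ k) →
        (toℕ p <ᵇ toℕ k) ≡ ((q <ᵇ seg la p) ∨ ((seg la p ≡ᵇ q) ∧ (toℕ p <ᵇ toℕ k)))
      by-position (yes p<k) rewrite <ᵇ-true p<k with q <ᵇ seg la p in q<?
      ... | true  = refl
      ... | false = sym (trans (∧-identityʳ _) (T-true (ℕP.≡⇒≡ᵇ (seg la p) q same-segment)))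
        where
        same-segment : seg la p ≡ q
        same-segment = ℕP.≤-antisym (ℕP.≮⇒≥ (λ q<s → contradiction (trans (sym (<ᵇ-true q<s)) q<?) (λ ())))
                                    (seg-antitone p k (ℕP.<⇒≤ p<k))
      by-position (no p≮k) rewrite <ᵇ-false p≮k | <ᵇ-false (ℕP.≤⇒≯ (seg-antitone k p (ℕP.≮⇒≥ p≮k))) =
        sym (∧-zeroʳ (seg la p ≡ᵇ q))
    disjoint : ∀ p → (inJ la J p ∧ (q <ᵇ seg la p)) ≡ true →
      (inJ la J p ∧ ((seg la p ≡ᵇ q) ∧ (toℕ p <ᵇ toℕ k))) ≡ false
    disjoint p beyond with inJ la J p
    ... | true  = cong (_∧ (toℕ p <ᵇ toℕ k)) (T-false (λ t → ℕP.<-irrefl (sym (ℕP.≡ᵇ⇒≡ (seg la p) q t)) (<ᵇ-sound {q} {seg la p} beyond)))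
    ... | false = refl
    ordered : ∀ {p p′ : Fin m} → toℕ p < toℕ p′ →
      (inJ la J p ∧ ((seg la p ≡ᵇ q) ∧ (toℕ p <ᵇ toℕ k))) ≡ true → (inJ la J p′ ∧ (q <ᵇ seg la p′)) ≡ false
    ordered {p} {p′} p<p′ in-seg = trans (cong (inJ la J p′ ∧_) (<ᵇ-false (ℕP.≤⇒≯ seg≤))) (∧-zeroʳ _)
      where
      seg≤ : seg la p′ ≤ q
      seg≤ = subst (seg la p′ ≤_)
                   (ℕP.≡ᵇ⇒≡ _ _ (proj₁ (T-∧⁻ (proj₂ (T-∧⁻ {inJ la J p} (true-T in-seg))))))
                   (seg-antitone p p′ (ℕP.<⇒≤ p<p′))

  -- descending induction on the column q = r + 1, starting beyond λ₁: w r̂_{T beyond q}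
  -- sends ρ_q to θ_q
  sends-above : ∀ d r → r ℕ.+ d ≡ λ₁ la → Sends (suc r) (Jabove la J (suc r))
  sends-above zero r r+0≡λ₁ =
    subst (λ q → Sends (suc q) (Jabove la J (suc q))) (trans (sym r+0≡λ₁) (ℕP.+-identityʳ r))
          (subst (Sends (suc (λ₁ la))) (sym above-top-empty) sends-top)
  sends-above (suc d) r r+1+d≡λ₁ =
    sends-lower r (subst (Sends (suc (suc r))) (sym (above-split (suc r)))
                         (sends-extend (suc (suc r)) (Jabove la J (suc (suc r))) (inSegment (suc (suc r))) (inSegment-seg (suc (suc r)))
                                       (sends-above d (suc r) (trans (sym (ℕP.+-suc r d)) r+1+d≡λ₁))))

  -- for q the segment of k, w r̂_{j₁} ⋯ r̂_{jᵢ} sends ρ_q to θ_q: the reflections of T in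
  -- the segment of k before k fix ρ_q
  sends-below : ∀ k → Sends (seg la k) (Jbelow la J k)
  sends-below k = subst (Sends (seg la k)) (sym (below-split k))
                        (sends-extend (seg la k) (Jabove la J (seg la k)) (earlier k) (earlier-seg k)
                                      (sends-segment (seg la k) 1≤q q≤λ₁))
    where
    1≤q : 1 ≤ seg la k
    1≤q = proj₁ (entry-tagged k)
    q≤λ₁ : seg la k ≤ λ₁ la
    q≤λ₁ = proj₁ (proj₂ (entry-tagged k))
    sends-segment : ∀ q → 1 ≤ q → q ≤ λ₁ la → Sends q (Jabove la J q)
    sends-segment (suc r) _ 1+r≤λ₁ = sends-above (λ₁ la ℕ.∸ r) r (ℕP.m+[n∸m]≡n (ℕP.<⇒≤ 1+r≤λ₁))

  affProd-affine : ∀ ps ν x → affProd la w ps ν (moved ps x) ≡ ν x + translation ps x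
  affProd-affine ps ν x = trans (cong (reflectAll ps ν) (inverseˡ w)) (reflectAll-affine ps ν x)

  image-constant : ∀ k →
    (ι (ℤ.+ lev la k) + translation (Jbelow la J k) (A k)) - translation (Jbelow la J k) (B k)
      ≡ ι ((ℤ.+ Ncount la w J (seg la k) (moved (Jbelow la J k) (A k)))
           ℤ.- (ℤ.+ Ncount la w J (seg la k) (moved (Jbelow la J k) (B k))))
  image-constant k = sym (begin
    ι (ℤ.+ Ncount la w J q (moved ps (A k)) ℤ.- ℤ.+ Ncount la w J q (moved ps (B k)))
      ≡⟨ ι-- (ℤ.+ Ncount la w J q (moved ps (A k))) (ℤ.+ Ncount la w J q (moved ps (B k))) ⟩
    content q (moved ps (A k)) - content q (moved ps (B k))
      ≡⟨ cong₂ _-_ (sends-below k (A k)) (sends-below k (B k)) ⟩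
    (shapeContent q (A k) + Ca) - (shapeContent q (B k) + Cb)
      ≡⟨ cong (λ s → (s + Ca) - (shapeContent q (B k) + Cb)) (shape-on-H q k refl) ⟩
    ((shapeContent q (B k) + l) + Ca) - (shapeContent q (B k) + Cb)
      ≡⟨ solve 4 (λ s l Ca Cb → ((s :+ l) :+ Ca) :- (s :+ Cb) := (l :+ Ca) :- Cb) refl (shapeContent q (B k)) l Ca Cb ⟩
    (l + Ca) - Cb ∎)
    where
    open ≡-Reasoning
    q = seg la k
    ps = Jbelow la J k
    l = ι (ℤ.+ lev la k)
    Ca = translation ps (A k)
    Cb = translation ps (B k)

open import Data.Nat.Base using (_≤_; _∸_)
open import Data.Integer.Base using (+_; _-_)

-- By hyperplane-image the hyperplane is H_{γ, l_k + C a - C b}, and image-constant identifies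
-- the constant with N_c(σ[q]) - N_d(σ[q]).

proposition4p1 : (n : ℕ) → 2 ≤ n → (la : Partition n) → nonzeroParts la ≤ n ∸ 1 →
    (w : Permutation′ n) → (J : Subset (len la)) → (k : Fin (len la)) →
    SameSet (Image (affProd la w (Jbelow la J k))
    (Hyp (proj₁ (β la k)) (proj₂ (β la k)) ((+ lev la k) / 1)))
    (Hyp (permProd la w (Jbelow la J k) (proj₁ (β la k)))
    (permProd la w (Jbelow la J k) (proj₂ (β la k)))
    (((+ Ncount la w J (seg la k) (permProd la w (Jbelow la J k) (proj₁ (β la k))))
    - (+ Ncount la w J (seg la k) (permProd la w (Jbelow la J k) (proj₂ (β la k))))) / 1))
proposition4p1 n _ la _ w J k =
  subst (λ h → SameSet (Image (affProd la w ps) (Hyp (A k) (B k) l)) (Hyp (moved ps (A k)) (moved ps (B k)) h))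
        (image-constant k)
        (hyperplane-image (affProd la w ps) (moved ps) (unmoved ps) (translation ps)
                          (moved-unmoved ps) (affProd-affine ps) (A k) (B k) l)
  where
  open Affine
  open Filling la w J
  ps = Jbelow la J k
  l = ι (+ lev la k)
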